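{- A graph $G=(V,E)$ is $1$-complete square-free word-representable if and only if $G$ is a complete graph.
   Context: For a word $w$ and a set $S$ of letters, $w_S$ is the word obtained from $w$ by deleting all letters not in $S$. Two distinct letters $x,y$ alternate in $w$ if $w_{\{x,y\}}$ is of the form $xyxy\cdots$ or $yxyx\cdots$ (even or odd length). A simple graph $G=(V,E)$ is word-representable if there is a word $w$ over $V$, containing every vertex, such that distinct $x,y$ alternate in $w$ iff $xy\in E$. A square is a factor (block of consecutive letters) $XX$ with $X$ non-empty. A word $w$ contains a $p$-complete square if there is a set $S$ of letters such that $w_S$ contains a square $XX$ with $|X|\ge p$; otherwise $w$ is $p$-complete square-free. A graph $G$ is $p$-complete square-free word-representable if it is represented by some word $w$ that is $p$-complete square-free, where $1\le p\le\lceil|w|/2\rceil$. -}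

module Defs where

open import Data.Nat using (ℕ; zero; suc; _≤_; ⌈_/2⌉)
open import Data.Fin using (Fin; _≟_)
open import Data.Bool using (Bool; true; false; _∨_; if_then_else_)
open import Data.List using (List; []; _∷_; _++_; length)
open import Data.List.Membership.Propositional using (_∈_)
open import Data.Sum using (_⊎_)
open import Data.Product using (Σ; _×_; ∃-syntax)
open import Relation.Nullary using (¬_)
open import Relation.Nullary.Decidable using (⌊_⌋)
open import Relation.Binary.PropositionalEquality using (_≡_; _≢_)
open import Function.Bundles using (_⇔_)

record Graph (n : ℕ) : Set₁ where
  field
    Edge  : Fin n → Fin n → Set
    sym   : ∀ {x y} → Edge x y → Edge y x
    irrefl : ∀ {x} → ¬ Edge x x
open Graph public

Word : ℕ → Set
Word n = List (Fin n)

restrict : ∀ {n} → (Fin n → Bool) → Word n → Word n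
restrict S []      = []
restrict S (a ∷ w) = if S a then a ∷ restrict S w else restrict S w

alt : ∀ {n} → Fin n → Fin n → ℕ → Word n
alt x y zero    = []
alt x y (suc k) = x ∷ alt y x k

pair : ∀ {n} → Fin n → Fin n → (Fin n → Bool)
pair x y a = ⌊ a ≟ x ⌋ ∨ ⌊ a ≟ y ⌋

Alternate : ∀ {n} → Fin n → Fin n → Word n → Set
Alternate x y w = ∃[ k ] ((restrict (pair x y) w ≡ alt x y k) ⊎ (restrict (pair x y) w ≡ alt y x k))

Represents : ∀ {n} → Graph n → Word n → Set
Represents {n} G w =
  (∀ (v : Fin n) → v ∈ w) ×
  (∀ (x y : Fin n) → x ≢ y → (Alternate x y w ⇔ Edge G x y))

ContainsSquare : ∀ {n} → ℕ → Word n → Set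
ContainsSquare {n} p u =
  ∃[ a ] ∃[ X ] ∃[ b ] ((u ≡ a ++ X ++ X ++ b) × (p ≤ length X))

ContainsCompleteSquare : ∀ {n} → ℕ → Word n → Set
ContainsCompleteSquare {n} p w =
  Σ (Fin n → Bool) λ S → ContainsSquare p (restrict S w)

CompleteSquareFreeRepresentable : ∀ {n} → ℕ → Graph n → Set
CompleteSquareFreeRepresentable {n} p G =
  Σ (Word n) λ w →
    Represents G w × (1 ≤ p) × (p ≤ ⌈ length w /2⌉) × ¬ ContainsCompleteSquare p w

Complete : ∀ {n} → Graph n → Set
Complete {n} G = ∀ (x y : Fin n) → x ≢ y → Edge G x y

-- In a 1-complete-square-free word no two equal letters are adjacent in any
-- restriction, so every restriction to a pair {x, y} alternates: such a word can
-- only represent a complete graph. Conversely, a word listing every vertex once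
-- has repetition-free restrictions, hence no square at all, and represents K_n.
module Submission where

open import Defs
open import Data.Nat using (ℕ; suc; s≤s; z≤n)
open import Data.Fin using (Fin; _≟_)
open import Data.Bool using (Bool; true; false; T)
open import Data.Bool.Properties using (T-∨)
open import Data.List using ([]; _∷_; _++_; allFin; filterᵇ)
open import Data.List.Relation.Unary.All as All using (All; _∷_)
open import Data.List.Relation.Unary.All.Properties using (all-filter; ++⁻ʳ)
open import Data.List.Relation.Unary.Unique.Propositional using (Unique; _∷_)
open import Data.List.Relation.Unary.Unique.Propositional.Properties
  using (allFin⁺; filter⁺)
open import Data.List.Membership.Propositional.Properties using (∈-allFin)
open import Data.Sum as Sum using (_⊎_; inj₁; inj₂)
open import Data.Product using (∃-syntax; _,_)
open import Function using (_∘_)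
open import Function.Bundles using (_⇔_; mk⇔; Equivalence)
open import Relation.Nullary using (¬_)
open import Relation.Nullary.Decidable using (T?; toWitness)
open import Relation.Binary.PropositionalEquality using (_≡_; _≢_; refl; cong)

module _ {n : ℕ} where

  restrict≡filterᵇ : (S : Fin n → Bool) (w : Word n) → restrict S w ≡ filterᵇ S w
  restrict≡filterᵇ S []      = refl
  restrict≡filterᵇ S (a ∷ w) with S a
  ... | true  = cong (a ∷_) (restrict≡filterᵇ S w)
  ... | false = restrict≡filterᵇ S w

  restrict-unique : (S : Fin n → Bool) {w : Word n} → Unique w → Unique (restrict S w)
  restrict-unique S {w} u rewrite restrict≡filterᵇ S w = filter⁺ (T? ∘ S) u

  restrict-pair-letters : (x y : Fin n) (w : Word n) →
                          All (λ a → a ≡ x ⊎ a ≡ y) (restrict (pair x y) w)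
  restrict-pair-letters x y w rewrite restrict≡filterᵇ (pair x y) w =
    All.map pair-letter (all-filter (T? ∘ pair x y) w)
    where
    pair-letter : ∀ {a} → T (pair x y a) → a ≡ x ⊎ a ≡ y
    pair-letter {a} = Sum.map (toWitness {a? = a ≟ x}) (toWitness {a? = a ≟ y})
                    ∘ Equivalence.to T-∨

  unique⇒¬square : {u : Word n} → Unique u → ¬ ContainsSquare 1 u
  unique⇒¬square u! (a , c ∷ X , b , refl , _) = first-letter-repeated a u!
    where
    first-letter-repeated : ∀ a → ¬ Unique (a ++ (c ∷ X) ++ (c ∷ X) ++ b)
    first-letter-repeated []      (c∉ ∷ _) with ++⁻ʳ X c∉
    ... | c≢c ∷ _ = c≢c refl
    first-letter-repeated (_ ∷ a) (_ ∷ u!) = first-letter-repeated a u!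

  square-∷ : ∀ {p c} {u : Word n} → ContainsSquare p u → ContainsSquare p (c ∷ u)
  square-∷ {c = c} (a , X , b , refl , p≤|X|) = c ∷ a , X , b , refl , p≤|X|

  doubled-letter-square : ∀ {c} {u : Word n} → ContainsSquare 1 (c ∷ c ∷ u)
  doubled-letter-square {c} {u} = [] , c ∷ [] , u , refl , s≤s z≤n

  Alternating : Fin n → Fin n → Word n → Set
  Alternating x y u = ∃[ k ] (u ≡ alt x y k ⊎ u ≡ alt y x k)

  alternating-swap : ∀ {x y u} → Alternating x y u → Alternating y x u
  alternating-swap (k , u≡) = k , Sum.swap u≡

  alternating-∷ : ∀ {x y u} → ¬ ContainsSquare 1 (x ∷ u) →
                  Alternating x y u → Alternating x y (x ∷ u)
  alternating-∷ _    (0     , inj₁ refl) = 1 , inj₁ refl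
  alternating-∷ ¬sq  (suc k , inj₁ refl) with () ← ¬sq doubled-letter-square
  alternating-∷ _    (k     , inj₂ refl) = suc k , inj₁ refl

  squareFree⇒alternating : (x y : Fin n) (u : Word n) → All (λ a → a ≡ x ⊎ a ≡ y) u →
                           ¬ ContainsSquare 1 u → Alternating x y u
  squareFree⇒alternating x y []      _            _   = 0 , inj₁ refl
  squareFree⇒alternating x y (c ∷ u) (c∈xy ∷ u∈xy) ¬sq
    with squareFree⇒alternating x y u u∈xy (¬sq ∘ square-∷)
  ... | u-alt with c∈xy
  ...   | inj₁ refl = alternating-∷ ¬sq u-alt
  ...   | inj₂ refl = alternating-swap (alternating-∷ ¬sq (alternating-swap u-alt))

  completeSquareFree⇒alternate : (w : Word n) → ¬ ContainsCompleteSquare 1 w →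
                                 (x y : Fin n) → Alternate x y w
  completeSquareFree⇒alternate w ¬sq x y =
    squareFree⇒alternating x y _ (restrict-pair-letters x y w) (¬sq ∘ (pair x y ,_))

  unique⇒completeSquareFree : (w : Word n) → Unique w → ¬ ContainsCompleteSquare 1 w
  unique⇒completeSquareFree _ w! (S , sq) = unique⇒¬square (restrict-unique S w!) sq

mainTheorem7 : (n : ℕ) (G : Graph (suc n)) →
    CompleteSquareFreeRepresentable 1 G ⇔ Complete G
mainTheorem7 n G = mk⇔ represented⇒complete complete⇒represented
  where
  represented⇒complete : CompleteSquareFreeRepresentable 1 G → Complete G
  represented⇒complete (w , (_ , alternate⇔edge) , _ , _ , ¬sq) x y x≢y =
    Equivalence.to (alternate⇔edge x y x≢y) (completeSquareFree⇒alternate w ¬sq x y)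

  complete⇒represented : Complete G → CompleteSquareFreeRepresentable 1 G
  complete⇒represented complete =
    allFin (suc n) , (∈-allFin , alternate⇔edge) , s≤s z≤n , s≤s z≤n , ¬sq
    where
    ¬sq : ¬ ContainsCompleteSquare 1 (allFin (suc n))
    ¬sq = unique⇒completeSquareFree (allFin (suc n)) (allFin⁺ (suc n))

    alternate⇔edge : ∀ x y → x ≢ y → Alternate x y (allFin (suc n)) ⇔ Edge G x y
    alternate⇔edge x y x≢y =
      mk⇔ (λ _ → complete x y x≢y)
          (λ _ → completeSquareFree⇒alternate (allFin (suc n)) ¬sq x y)
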